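{- If $n = ab$ with $a,b$ positive integers satisfying $2\sqrt{b} < a \le b$, then $\lambda(n) \le \sqrt{n}$.
   Context: All posets are finite. A linear extension of a poset $P=(X,\preceq)$ is a total ordering of $X$ compatible with $\preceq$; $e(P)$ denotes the number of linear extensions of $P$. The size $|P|$ of $P$ is $|X|$. For an integer $n\ge 1$, $\lambda(n)=\min\{|P| : e(P)=n\}$ (the empty poset has exactly one linear extension, so $\lambda(1)=0$). -}

module Defs where

open import Data.Nat using (ℕ; zero; suc; _≤_)
open import Data.Bool using (Bool; true; false; _∧_; if_then_else_)
open import Data.Fin using (Fin; _≟_) renaming (_≤?_ to _≤ᶠ?_)
open import Data.Fin.Base using (_≤_)
open import Data.List using (List; []; _∷_; concatMap; map; length; filter; allFin)
open import Data.Bool.ListAction using (all)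
open import Data.Vec using (Vec; []; _∷_; lookup)
open import Relation.Binary.PropositionalEquality using (_≡_)
open import Relation.Nullary.Decidable using (⌊_⌋)

record FinPoset : Set where
  field
    size  : ℕ
    leq   : Fin size → Fin size → Bool
    refl' : ∀ x → leq x x ≡ true
    antisym' : ∀ x y → leq x y ≡ true → leq y x ≡ true → x ≡ y
    trans' : ∀ x y z → leq x y ≡ true → leq y z ≡ true → leq x z ≡ true

allVecs : (m k : ℕ) → List (Vec (Fin m) k)
allVecs m zero = [] ∷ []
allVecs m (suc k) = concatMap (λ v → map (_∷ v) (allFin m)) (allVecs m k)

-- A linear extension of P is encoded by the map  pos : X → Fin |X|  assigning
-- to each element its position in the total order; it must be a bijection
-- (equivalently, on a finite set of this size, injective) and order-preserving:
-- x ⪯ y  implies  pos x ≤ pos y.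
isLinExt : (P : FinPoset) → Vec (Fin (FinPoset.size P)) (FinPoset.size P) → Bool
isLinExt P v =
  all (λ x → all (λ y →
        (if ⌊ lookup v x ≟ lookup v y ⌋ then ⌊ x ≟ y ⌋ else true)
      ∧ (if FinPoset.leq P x y then ⌊ lookup v x ≤ᶠ? lookup v y ⌋ else true))
      (allFin n)) (allFin n)
  where n = FinPoset.size P

e : FinPoset → ℕ
e P = length (filter (λ v → isLinExt P v ≟ᵇ true) (allVecs n n))
  where
    n = FinPoset.size P
    open import Data.Bool.Properties renaming (_≟_ to _≟ᵇ_)

-- λ(n) ≤ √n  iff  some poset P with e(P) = n has |P| ≤ √n, i.e. |P|² ≤ n
-- (λ(n) is the minimum size of a poset with exactly n linear extensions;
-- for natural k and n, k ≤ √n iff k * k ≤ n).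
λ≤√ : ℕ → Set
λ≤√ n = Σ FinPoset (λ P → (FinPoset.size P * FinPoset.size P Data.Nat.≤ n) × (e P ≡ n))
  where
    open import Data.Product using (Σ; _×_)
    open import Data.Nat using (_*_)

module Submission where

-- Write b = (u+o+1)(o+v+1) + (o+1) with u+o+v+3 ≤ a (by comparing b with the
-- nearby squares).  On a chain c₀ < … < c_{m-1}, m = a − 3, add a point x below
-- c_{u+o}, …; a point y above c₀, …, c_{u-1} and below c_{u+o+v}, …; and an
-- isolated point z (all other pairs incomparable).  x and y fit into u+o+1 and o+v+1 slots of the chain, the
-- o+1 common slots taking both orders of x and y, and z multiplies by a.
-- So e(P) = a·b while |P|² = a² ≤ a·b.

open import Defs
open import Data.Nat.Properties
open import Algebra.Properties.Semiring.Sum +-*-semiring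
  using (sum; sum-syntax; sum-cong-≗; sum-remove; sum-replicate-zero; ∑-comm)
open import Data.Bool using (Bool; true; false; T; _∧_; if_then_else_)
open import Data.Bool.ListAction using (all; and)
open import Data.Bool.Properties using (T-∧; T-≡) renaming (_≟_ to _≟ᵇ_)
open import Data.Empty using (⊥-elim)
open import Data.Fin as F using (Fin; zero; suc; toℕ; punchIn; punchOut; fromℕ; fromℕ<; _↑ˡ_; _↑ʳ_)
open import Data.Fin.Properties as FP
  using ( punchInᵢ≢i; punchIn-injective; punchIn-mono-≤; punchIn-cancel-≤; punchIn-punchOut
        ; ≤fromℕ; injective⇒existsPivot; toℕ-injective; toℕ<n; toℕ-fromℕ; toℕ-fromℕ<; toℕ-↑ˡ; toℕ-↑ʳ )
open import Data.List using (List; []; _∷_; _++_; map; concatMap; length; filter; tabulate; allFin)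
open import Data.List.Properties using (map-cong)
open import Data.List.Relation.Unary.All.Properties using (all⁺; all⁻; tabulate⁺; tabulate⁻)
open import Data.Nat
open import Data.Nat.Tactic.RingSolver using (solve-∀)
open import Data.Product using (_×_; _,_; proj₁; proj₂; ∃; ∃₂)
open import Data.Sum using (_⊎_; inj₁; inj₂)
open import Data.Unit using (tt)
open import Data.Vec as V using (Vec; []; _∷_; lookup; insertAt)
open import Data.Vec.Properties using (insertAt-lookup; insertAt-punchIn; lookup-map)
open import Function using (_∘_; _⇔_; mk⇔; Equivalence)
open import Relation.Binary.PropositionalEquality hiding (poset)
open import Relation.Nullary using (¬_)
open import Relation.Nullary.Decidable using (⌊_⌋; yes; no; isYes≗does; dec-true; dec-false)

open Equivalence using (to; from)

𝟙 : Bool → ℕ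
𝟙 true  = 1
𝟙 false = 0

𝟙-≡0 : ∀ {b} → ¬ T b → 𝟙 b ≡ 0
𝟙-≡0 {false} _  = refl
𝟙-≡0 {true}  ¬b = ⊥-elim (¬b tt)

T-ext : ∀ {a b} → (T a → T b) → (T b → T a) → a ≡ b
T-ext {false} {false} _   _   = refl
T-ext {false} {true}  _   b⇒a = ⊥-elim (b⇒a tt)
T-ext {true}  {false} a⇒b _   = ⊥-elim (a⇒b tt)
T-ext {true}  {true}  _   _   = refl

⌊≟⌋-refl : ∀ {m} (p : Fin m) → ⌊ p F.≟ p ⌋ ≡ true
⌊≟⌋-refl p = trans (isYes≗does (p F.≟ p)) (dec-true (p F.≟ p) refl)

⌊≟⌋-≢ : ∀ {m} {p q : Fin m} → p ≢ q → ⌊ p F.≟ q ⌋ ≡ false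
⌊≟⌋-≢ {p = p} {q} p≢q = trans (isYes≗does (p F.≟ q)) (dec-false (p F.≟ q) p≢q)

∑-single : ∀ {m} (p : Fin (suc m)) (g : Fin (suc m) → ℕ) → (∀ j → g (punchIn p j) ≡ 0) → sum g ≡ g p
∑-single {m} p g rest≡0 =
  trans (sum-remove {i = p} g)
        (trans (cong (g p +_) (trans (sum-cong-≗ {m} rest≡0) (sum-replicate-zero m))) (+-identityʳ (g p)))

∑-remove-zero : ∀ {n} (p : Fin (suc n)) (h : Fin (suc n) → ℕ) → h p ≡ 0 → sum h ≡ ∑[ j < n ] h (punchIn p j)
∑-remove-zero {n} p h hp≡0 = trans (sum-remove {i = p} h) (cong (λ z → z + ∑[ j < n ] h (punchIn p j)) hp≡0)

∑-δˡ : ∀ {m} (p : Fin m) (g : Fin m → ℕ) → ∑[ i < m ] (𝟙 ⌊ i F.≟ p ⌋ * g i) ≡ g p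
∑-δˡ {suc m} p g =
  trans (∑-single p (λ i → 𝟙 ⌊ i F.≟ p ⌋ * g i) (λ j → cong (λ b → 𝟙 b * g (punchIn p j)) (⌊≟⌋-≢ (punchInᵢ≢i p j))))
        (trans (cong (λ b → 𝟙 b * g p) (⌊≟⌋-refl p)) (*-identityˡ (g p)))

∑-δʳ : ∀ {m} (a : Fin m) (c : ℕ) → ∑[ p < m ] (𝟙 ⌊ a F.≟ p ⌋ * c) ≡ c
∑-δʳ {suc m} a c =
  trans (∑-single a (λ p → 𝟙 ⌊ a F.≟ p ⌋ * c) (λ j → cong (λ b → 𝟙 b * c) (⌊≟⌋-≢ (punchInᵢ≢i a j ∘ sym))))
        (trans (cong (λ b → 𝟙 b * c) (⌊≟⌋-refl a)) (*-identityˡ c))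

∑-const : ∀ m c → ∑[ i < m ] c ≡ m * c
∑-const zero    c = refl
∑-const (suc m) c = cong (c +_) (∑-const m c)

∑-last : ∀ {m} (f : Fin (suc m) → ℕ) → (∀ i → toℕ i < m → f i ≡ 0) → sum f ≡ f (fromℕ m)
∑-last {zero}  f _        = +-identityʳ (f zero)
∑-last {suc m} f initial≡0 rewrite initial≡0 zero z<s = ∑-last (f ∘ suc) (λ i i<m → initial≡0 (suc i) (s<s i<m))

∑-↑ : ∀ {a b} (f : Fin (a + b) → ℕ) → sum f ≡ ∑[ i < a ] f (i ↑ˡ b) + ∑[ k < b ] f (a ↑ʳ k)
∑-↑ {zero}      f = refl
∑-↑ {suc a} {b} f = trans (cong (f zero +_) (∑-↑ {a} {b} (f ∘ suc))) (sym (+-assoc (f zero) _ _))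

-- Sums over the vectors Vec (Fin m) k, in the order in which allVecs lists them.
∑Vec : (m k : ℕ) → (Vec (Fin m) k → ℕ) → ℕ
∑Vec m zero    f = f []
∑Vec m (suc k) f = ∑Vec m k (λ v → ∑[ i < m ] f (i ∷ v))

∑List : {A : Set} → (A → ℕ) → List A → ℕ
∑List f []       = 0
∑List f (x ∷ xs) = f x + ∑List f xs

∑List-++ : {A : Set} (f : A → ℕ) (xs ys : List A) → ∑List f (xs ++ ys) ≡ ∑List f xs + ∑List f ys
∑List-++ f []       ys = refl
∑List-++ f (x ∷ xs) ys = trans (cong (f x +_) (∑List-++ f xs ys)) (sym (+-assoc (f x) _ _))

∑List-map-tabulate : ∀ {m} {A B : Set} (f : B → ℕ) (g : A → B) (h : Fin m → A) →
                     ∑List f (map g (tabulate h)) ≡ ∑[ i < m ] f (g (h i))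
∑List-map-tabulate {zero}  f g h = refl
∑List-map-tabulate {suc m} f g h = cong (f (g (h zero)) +_) (∑List-map-tabulate f g (h ∘ suc))

∑List-allVecs : ∀ m k (f : Vec (Fin m) k → ℕ) → ∑List f (allVecs m k) ≡ ∑Vec m k f
∑List-allVecs m zero    f = +-identityʳ (f [])
∑List-allVecs m (suc k) f = trans (extend (allVecs m k)) (∑List-allVecs m k _)
  where
  extend : ∀ vs → ∑List f (concatMap (λ v → map (_∷ v) (allFin m)) vs) ≡ ∑List (λ v → ∑[ i < m ] f (i ∷ v)) vs
  extend []       = refl
  extend (v ∷ vs) = trans (∑List-++ f (map (_∷ v) (allFin m)) _)
                          (cong₂ _+_ (∑List-map-tabulate f (_∷ v) (λ i → i)) (extend vs))

count-filter : ∀ {A : Set} (p : A → Bool) xs → length (filter (λ x → p x ≟ᵇ true) xs) ≡ ∑List (𝟙 ∘ p) xs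
count-filter p []       = refl
count-filter p (x ∷ xs) with p x
... | true  = cong suc (count-filter p xs)
... | false = count-filter p xs

∑Vec-cong : ∀ {m k} {f g : Vec (Fin m) k → ℕ} → (∀ v → f v ≡ g v) → ∑Vec m k f ≡ ∑Vec m k g
∑Vec-cong {k = zero}  f≗g = f≗g []
∑Vec-cong {k = suc k} f≗g = ∑Vec-cong (λ v → sum-cong-≗ (λ i → f≗g (i ∷ v)))

∑Vec-zero : ∀ m k → ∑Vec m k (λ _ → 0) ≡ 0
∑Vec-zero m zero    = refl
∑Vec-zero m (suc k) = trans (∑Vec-cong {m} {k} (λ _ → sum-replicate-zero m)) (∑Vec-zero m k)

∑Vec-∑-comm : ∀ {n m k} (g : Fin n → Vec (Fin m) k → ℕ) →
              ∑Vec m k (λ v → ∑[ i < n ] g i v) ≡ ∑[ i < n ] ∑Vec m k (g i)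
∑Vec-∑-comm {k = zero}      g = refl
∑Vec-∑-comm {n} {m} {suc k} g =
  trans (∑Vec-cong {m} {k} (λ v → ∑-comm (λ j i → g i (j ∷ v)))) (∑Vec-∑-comm (λ i v → ∑[ j < m ] g i (j ∷ v)))

∑Vec-insertAt : ∀ m k (x : Fin (suc k)) (f : Vec (Fin m) (suc k) → ℕ) →
                ∑Vec m (suc k) f ≡ ∑[ i < m ] ∑Vec m k (λ w → f (insertAt w x i))
∑Vec-insertAt m k       zero    f = ∑Vec-∑-comm (λ i v → f (i ∷ v))
∑Vec-insertAt m (suc k) (suc x) f = ∑Vec-insertAt m k x (λ v → ∑[ j < m ] f (j ∷ v))

∑Vec-avoid : ∀ n k (p : Fin (suc n)) (f : Vec (Fin (suc n)) k → ℕ) → (∀ w j → lookup w j ≡ p → f w ≡ 0) →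
             ∑Vec (suc n) k f ≡ ∑Vec n k (λ w → f (V.map (punchIn p) w))
∑Vec-avoid n zero    p f f-vanishes = refl
∑Vec-avoid n (suc k) p f f-vanishes =
  trans (∑Vec-avoid n k p _ column-vanishes)
        (∑Vec-cong {n} {k} (λ w → ∑-remove-zero p (λ i → f (i ∷ V.map (punchIn p) w))
                                                  (f-vanishes (p ∷ V.map (punchIn p) w) zero refl)))
  where
  column-vanishes : ∀ w j → lookup w j ≡ p → ∑[ i < suc n ] f (i ∷ w) ≡ 0
  column-vanishes w j wj≡p = trans (sum-cong-≗ (λ i → f-vanishes (i ∷ w) (suc j) wj≡p)) (sum-replicate-zero (suc n))

∑Vec-fix : ∀ n (x p : Fin (suc n)) (f : Vec (Fin (suc n)) (suc n) → ℕ) →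
           (∀ v i j → i ≢ j → lookup v i ≡ lookup v j → f v ≡ 0) →
           ∑Vec (suc n) (suc n) (λ v → 𝟙 ⌊ lookup v x F.≟ p ⌋ * f v)
             ≡ ∑Vec n n (λ w → f (insertAt (V.map (punchIn p) w) x p))
∑Vec-fix n x p f f-repeat = begin
  ∑Vec (suc n) (suc n) (λ v → 𝟙 ⌊ lookup v x F.≟ p ⌋ * f v)
    ≡⟨ ∑Vec-insertAt (suc n) n x (λ v → 𝟙 ⌊ lookup v x F.≟ p ⌋ * f v) ⟩
  ∑[ i < suc n ] ∑Vec (suc n) n (λ w → 𝟙 ⌊ lookup (insertAt w x i) x F.≟ p ⌋ * f (insertAt w x i))
    ≡⟨ sum-cong-≗ (λ i → ∑Vec-cong {suc n} {n} (λ w →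
         cong (λ q → 𝟙 ⌊ q F.≟ p ⌋ * f (insertAt w x i)) (insertAt-lookup w x i))) ⟩
  ∑[ i < suc n ] ∑Vec (suc n) n (λ w → 𝟙 ⌊ i F.≟ p ⌋ * f (insertAt w x i))
    ≡⟨ sym (∑Vec-∑-comm (λ i w → 𝟙 ⌊ i F.≟ p ⌋ * f (insertAt w x i))) ⟩
  ∑Vec (suc n) n (λ w → ∑[ i < suc n ] (𝟙 ⌊ i F.≟ p ⌋ * f (insertAt w x i)))
    ≡⟨ ∑Vec-cong {suc n} {n} (λ w → ∑-δˡ p (λ i → f (insertAt w x i))) ⟩
  ∑Vec (suc n) n (λ w → f (insertAt w x p))
    ≡⟨ ∑Vec-avoid n n p (λ w → f (insertAt w x p)) p-repeated ⟩
  ∑Vec n n (λ w → f (insertAt (V.map (punchIn p) w) x p)) ∎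
  where
  open ≡-Reasoning
  p-repeated : ∀ w j → lookup w j ≡ p → f (insertAt w x p) ≡ 0
  p-repeated w j wj≡p = f-repeat _ (punchIn x j) x (punchInᵢ≢i x j)
    (trans (insertAt-punchIn w x p j) (trans wj≡p (sym (insertAt-lookup w x p))))

Rel : ℕ → Set
Rel n = Fin n → Fin n → Bool

linExt? : (n : ℕ) → Rel n → Vec (Fin n) n → Bool
linExt? n R v =
  all (λ x → all (λ y →
        (if ⌊ lookup v x F.≟ lookup v y ⌋ then ⌊ x F.≟ y ⌋ else true)
      ∧ (if R x y then ⌊ lookup v x F.≤? lookup v y ⌋ else true))
      (allFin n)) (allFin n)

record IsLinExt {n} (R : Rel n) (v : Vec (Fin n) n) : Set where
  constructor linExt
  field
    injective : ∀ i j → lookup v i ≡ lookup v j → i ≡ j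
    monotone  : ∀ i j → T (R i j) → lookup v i F.≤ lookup v j

open IsLinExt

T-all-allFin : ∀ {n} (p : Fin n → Bool) → T (all p (allFin n)) ⇔ (∀ i → T (p i))
T-all-allFin p = mk⇔ (tabulate⁻ ∘ all⁺ p _) (all⁻ p ∘ tabulate⁺)

T-if-≟ : ∀ {n m} (a b : Fin n) (x y : Fin m) → T (if ⌊ a F.≟ b ⌋ then ⌊ x F.≟ y ⌋ else true) ⇔ (a ≡ b → x ≡ y)
T-if-≟ a b x y with a F.≟ b | x F.≟ y
... | yes _   | yes x≡y = mk⇔ (λ _ _ → x≡y) (λ _ → tt)
... | yes a≡b | no x≢y  = mk⇔ (λ ()) (λ h → x≢y (h a≡b))
... | no a≢b  | _       = mk⇔ (λ _ a≡b → ⊥-elim (a≢b a≡b)) (λ _ → tt)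

T-if-≤ : ∀ {n} (r : Bool) (a b : Fin n) → T (if r then ⌊ a F.≤? b ⌋ else true) ⇔ (T r → a F.≤ b)
T-if-≤ false a b = mk⇔ (λ _ ()) (λ _ → tt)
T-if-≤ true  a b with a F.≤? b
... | yes a≤b = mk⇔ (λ _ _ → a≤b) (λ _ → tt)
... | no  a≰b = mk⇔ (λ ()) (λ h → a≰b (h tt))

linExt?-sound : ∀ {n} (R : Rel n) v → T (linExt? n R v) → IsLinExt R v
linExt?-sound R v t =
  linExt (λ i j → to (T-if-≟ _ _ i j) (proj₁ (conditions i j)))
         (λ i j → to (T-if-≤ (R i j) _ _) (proj₂ (conditions i j)))
  where
  conditions : ∀ i j → T (if ⌊ lookup v i F.≟ lookup v j ⌋ then ⌊ i F.≟ j ⌋ else true)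
                     × T (if R i j then ⌊ lookup v i F.≤? lookup v j ⌋ else true)
  conditions i j = to T-∧ (to (T-all-allFin _) (to (T-all-allFin _) t i) j)

linExt?-complete : ∀ {n} (R : Rel n) v → IsLinExt R v → T (linExt? n R v)
linExt?-complete R v ext = from (T-all-allFin _) (λ i → from (T-all-allFin _) (λ j →
  from T-∧ (from (T-if-≟ _ _ i j) (injective ext i j) , from (T-if-≤ (R i j) _ _) (monotone ext i j))))

E : (n : ℕ) → Rel n → ℕ
E n R = ∑Vec n n (𝟙 ∘ linExt? n R)

e≡E : ∀ P → e P ≡ E (FinPoset.size P) (FinPoset.leq P)
e≡E P = trans (count-filter (isLinExt P) (allVecs n n)) (∑List-allVecs n n _)
  where n = FinPoset.size P

E-cong : ∀ {n} {R R′ : Rel n} → (∀ i j → R i j ≡ R′ i j) → E n R ≡ E n R′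
E-cong {n} {R} {R′} R≗R′ = ∑Vec-cong (λ v → cong 𝟙 (cong and (map-cong (λ x → cong and (map-cong (λ y →
  cong (λ r → (if ⌊ lookup v x F.≟ lookup v y ⌋ then ⌊ x F.≟ y ⌋ else true)
            ∧ (if r then ⌊ lookup v x F.≤? lookup v y ⌋ else true)) (R≗R′ x y)) (allFin n))) (allFin n))))

module Deletion {n : ℕ} (R : Rel (suc n)) (x : Fin (suc n)) where

  R∖x : Rel n
  R∖x i j = R (punchIn x i) (punchIn x j)

  -- The arrangement putting x at position p and the other elements in the
  -- relative order w.
  place : Fin (suc n) → Vec (Fin n) n → Vec (Fin (suc n)) (suc n)
  place p w = insertAt (V.map (punchIn p) w) x p

  place-x : ∀ p w → lookup (place p w) x ≡ p
  place-x p w = insertAt-lookup _ x p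

  place-other : ∀ p w j → lookup (place p w) (punchIn x j) ≡ punchIn p (lookup w j)
  place-other p w j = trans (insertAt-punchIn _ x p j) (lookup-map j (punchIn p) w)

  Compatible : Fin (suc n) → Vec (Fin n) n → Set
  Compatible p w = ∀ j → (T (R (punchIn x j) x) → punchIn p (lookup w j) F.≤ p)
                       × (T (R x (punchIn x j)) → p F.≤ punchIn p (lookup w j))

  elementView : ∀ i → i ≡ x ⊎ ∃ λ j → punchIn x j ≡ i
  elementView i with i F.≟ x
  ... | yes i≡x = inj₁ i≡x
  ... | no  i≢x = inj₂ (punchOut (i≢x ∘ sym) , punchIn-punchOut (i≢x ∘ sym))

  place-linExt⁻ : ∀ p w → IsLinExt R (place p w) → IsLinExt R∖x w × Compatible p w
  place-linExt⁻ p w ext =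
    linExt (λ i j wi≡wj → punchIn-injective x i j (injective ext _ _ (begin
              lookup (place p w) (punchIn x i) ≡⟨ place-other p w i ⟩
              punchIn p (lookup w i)           ≡⟨ cong (punchIn p) wi≡wj ⟩
              punchIn p (lookup w j)           ≡⟨ place-other p w j ⟨
              lookup (place p w) (punchIn x j) ∎)))
           (λ i j r → punchIn-cancel-≤ p _ _ (subst₂ F._≤_ (place-other p w i) (place-other p w j) (monotone ext _ _ r)))
    , λ j → (λ r → subst₂ F._≤_ (place-other p w j) (place-x p w) (monotone ext _ _ r))
          , (λ r → subst₂ F._≤_ (place-x p w) (place-other p w j) (monotone ext _ _ r))
    where open ≡-Reasoning

  place-linExt⁺ : ∀ p w → IsLinExt R∖x w → Compatible p w → IsLinExt R (place p w)
  place-linExt⁺ p w ext compatible = linExt inj mono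
    where
    inj : ∀ i k → lookup (place p w) i ≡ lookup (place p w) k → i ≡ k
    inj i k eq with elementView i | elementView k
    ... | inj₁ refl       | inj₁ refl        = refl
    ... | inj₁ refl       | inj₂ (j , refl)  =
      ⊥-elim (punchInᵢ≢i p (lookup w j) (sym (trans (sym (place-x p w)) (trans eq (place-other p w j)))))
    ... | inj₂ (j , refl) | inj₁ refl        =
      ⊥-elim (punchInᵢ≢i p (lookup w j) (trans (sym (place-other p w j)) (trans eq (place-x p w))))
    ... | inj₂ (j , refl) | inj₂ (j′ , refl) = cong (punchIn x) (injective ext j j′
      (punchIn-injective p _ _ (trans (sym (place-other p w j)) (trans eq (place-other p w j′)))))
    mono : ∀ i k → T (R i k) → lookup (place p w) i F.≤ lookup (place p w) k
    mono i k r with elementView i | elementView k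
    ... | inj₁ refl       | inj₁ refl        = FP.≤-refl
    ... | inj₁ refl       | inj₂ (j , refl)  =
      subst₂ F._≤_ (sym (place-x p w)) (sym (place-other p w j)) (proj₂ (compatible j) r)
    ... | inj₂ (j , refl) | inj₁ refl        =
      subst₂ F._≤_ (sym (place-other p w j)) (sym (place-x p w)) (proj₁ (compatible j) r)
    ... | inj₂ (j , refl) | inj₂ (j′ , refl) =
      subst₂ F._≤_ (sym (place-other p w j)) (sym (place-other p w j′)) (punchIn-mono-≤ p _ _ (monotone ext j j′ r))

  placed-as : ∀ p w → Compatible p w → linExt? (suc n) R (place p w) ≡ linExt? n R∖x w
  placed-as p w compatible = T-ext
    (λ t → linExt?-complete R∖x w (proj₁ (place-linExt⁻ p w (linExt?-sound R _ t))))
    (λ t → linExt?-complete R _ (place-linExt⁺ p w (linExt?-sound R∖x w t) compatible))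

  count-at : ∀ p → ∑Vec (suc n) (suc n) (λ v → 𝟙 ⌊ lookup v x F.≟ p ⌋ * 𝟙 (linExt? (suc n) R v))
                   ≡ ∑Vec n n (λ w → 𝟙 (linExt? (suc n) R (place p w)))
  count-at p = ∑Vec-fix n x p (𝟙 ∘ linExt? (suc n) R)
    (λ v i j i≢j vi≡vj → 𝟙-≡0 (λ t → i≢j (injective (linExt?-sound R v t) i j vi≡vj)))

  -- An element incomparable to all others can take any of the suc n positions.
  E-isolated : (∀ j → ¬ T (R x (punchIn x j))) → (∀ j → ¬ T (R (punchIn x j) x)) →
               E (suc n) R ≡ suc n * E n R∖x
  E-isolated not-below not-above = begin
    E (suc n) R
      ≡⟨ ∑Vec-cong {suc n} {suc n} (λ v → sym (∑-δʳ (lookup v x) (𝟙 (linExt? (suc n) R v)))) ⟩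
    ∑Vec (suc n) (suc n) (λ v → ∑[ p < suc n ] (𝟙 ⌊ lookup v x F.≟ p ⌋ * 𝟙 (linExt? (suc n) R v)))
      ≡⟨ ∑Vec-∑-comm (λ p v → 𝟙 ⌊ lookup v x F.≟ p ⌋ * 𝟙 (linExt? (suc n) R v)) ⟩
    ∑[ p < suc n ] ∑Vec (suc n) (suc n) (λ v → 𝟙 ⌊ lookup v x F.≟ p ⌋ * 𝟙 (linExt? (suc n) R v))
      ≡⟨ sum-cong-≗ (λ p → trans (count-at p) (∑Vec-cong (λ w → cong 𝟙 (placed-as p w (λ j →
           (λ r → ⊥-elim (not-above j r)) , (λ r → ⊥-elim (not-below j r))))))) ⟩
    ∑[ p < suc n ] E n R∖x
      ≡⟨ ∑-const (suc n) (E n R∖x) ⟩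
    suc n * E n R∖x ∎
    where open ≡-Reasoning

  lastCount : ℕ
  lastCount = ∑Vec n n (λ w → 𝟙 (linExt? (suc n) R (place (fromℕ n) w)))

  lastCount-maximal : (∀ j → ¬ T (R x (punchIn x j))) → lastCount ≡ E n R∖x
  lastCount-maximal maximal = ∑Vec-cong (λ w → cong 𝟙 (placed-as (fromℕ n) w (λ j →
    (λ _ → ≤fromℕ _) , (λ r → ⊥-elim (maximal j r)))))

  lastCount-nonmaximal : ∀ j → T (R x (punchIn x j)) → lastCount ≡ 0
  lastCount-nonmaximal j x<j = trans (∑Vec-cong (λ w → 𝟙-≡0 (λ t →
      punchInᵢ≢i (fromℕ n) (lookup w j) (FP.≤-antisym (≤fromℕ _)
        (proj₂ (proj₂ (place-linExt⁻ (fromℕ n) w (linExt?-sound R _ t)) j) x<j)))))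
    (∑Vec-zero n n)

-- Every linear extension puts exactly one element last.
E-byLast : ∀ n (R : Rel (suc n)) → E (suc n) R ≡ ∑[ x < suc n ] Deletion.lastCount R x
E-byLast n R = begin
  E (suc n) R
    ≡⟨ ∑Vec-cong one-last ⟩
  ∑Vec (suc n) (suc n) (λ v → ∑[ x < suc n ] (𝟙 ⌊ lookup v x F.≟ fromℕ n ⌋ * 𝟙 (linExt? (suc n) R v)))
    ≡⟨ ∑Vec-∑-comm (λ x v → 𝟙 ⌊ lookup v x F.≟ fromℕ n ⌋ * 𝟙 (linExt? (suc n) R v)) ⟩
  ∑[ x < suc n ] ∑Vec (suc n) (suc n) (λ v → 𝟙 ⌊ lookup v x F.≟ fromℕ n ⌋ * 𝟙 (linExt? (suc n) R v))
    ≡⟨ sum-cong-≗ (λ x → Deletion.count-at R x (fromℕ n)) ⟩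
  ∑[ x < suc n ] Deletion.lastCount R x ∎
  where
  open ≡-Reasoning
  one-last : ∀ v → 𝟙 (linExt? (suc n) R v) ≡ ∑[ x < suc n ] (𝟙 ⌊ lookup v x F.≟ fromℕ n ⌋ * 𝟙 (linExt? (suc n) R v))
  one-last v with linExt? (suc n) R v in lin
  ... | false = sym (trans (sum-cong-≗ (λ x → *-zeroʳ (𝟙 ⌊ lookup v x F.≟ fromℕ n ⌋))) (sum-replicate-zero (suc n)))
  ... | true  = sym (trans (∑-single a (λ x → 𝟙 ⌊ lookup v x F.≟ fromℕ n ⌋ * 1) others-not-last) a-last)
    where
    ext : IsLinExt R v
    ext = linExt?-sound R v (subst T (sym lin) tt)
    -- an injective map Fin (suc n) → Fin (suc n) reaches the last position
    pivot : ∃ λ j → j F.≤ fromℕ n × fromℕ n F.≤ lookup v j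
    pivot = injective⇒existsPivot (λ {i} {j} → injective ext i j) (fromℕ n)
    a : Fin (suc n)
    a = proj₁ pivot
    va≡last : lookup v a ≡ fromℕ n
    va≡last = FP.≤-antisym (≤fromℕ _) (proj₂ (proj₂ pivot))
    a-last : 𝟙 ⌊ lookup v a F.≟ fromℕ n ⌋ * 1 ≡ 1
    a-last = trans (cong (λ q → 𝟙 ⌊ q F.≟ fromℕ n ⌋ * 1) va≡last) (cong (λ b → 𝟙 b * 1) (⌊≟⌋-refl (fromℕ n)))
    others-not-last : ∀ j → 𝟙 ⌊ lookup v (punchIn a j) F.≟ fromℕ n ⌋ * 1 ≡ 0
    others-not-last j = cong (λ b → 𝟙 b * 1) (⌊≟⌋-≢ (λ eq → punchInᵢ≢i a j (injective ext _ _ (trans eq (sym va≡last)))))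

-- Relations on ℕ, restricted to Fin n.  Deleting the element X of
-- {0, …, n} corresponds to re-indexing through skip X, the ℕ-version of punchIn.
onFin : (ℕ → ℕ → Bool) → (n : ℕ) → Rel n
onFin S n i j = S (toℕ i) (toℕ j)

¬T⇒≡false : ∀ {b} → ¬ T b → b ≡ false
¬T⇒≡false {false} _  = refl
¬T⇒≡false {true}  ¬b = ⊥-elim (¬b tt)

<ᵇ-true : ∀ {i m} → i < m → (i <ᵇ m) ≡ true
<ᵇ-true = to T-≡ ∘ <⇒<ᵇ

<ᵇ-false : ∀ {i m} → m ≤ i → (i <ᵇ m) ≡ false
<ᵇ-false {i} {m} m≤i = ¬T⇒≡false (λ t → <⇒≱ (<ᵇ⇒< i m t) m≤i)

≤ᵇ-false : ∀ {i m} → m < i → (i ≤ᵇ m) ≡ false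
≤ᵇ-false {i} {m} m<i = ¬T⇒≡false (λ t → <⇒≱ m<i (≤ᵇ⇒≤ i m t))

skip : ℕ → ℕ → ℕ
skip X j = if j <ᵇ X then j else suc j

skip-< : ∀ {X j} → j < X → skip X j ≡ j
skip-< j<X rewrite <ᵇ-true j<X = refl

skip-≥ : ∀ {X j} → X ≤ j → skip X j ≡ suc j
skip-≥ X≤j rewrite <ᵇ-false X≤j = refl

toℕ-punchIn : ∀ {n} (x : Fin (suc n)) (j : Fin n) → toℕ (punchIn x j) ≡ skip (toℕ x) (toℕ j)
toℕ-punchIn zero    j       = refl
toℕ-punchIn (suc x) zero    = refl
toℕ-punchIn (suc x) (suc j) with toℕ j <? toℕ x
... | yes j<x rewrite toℕ-punchIn x j | skip-< j<x | skip-< (s≤s j<x) = refl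
... | no  j≮x rewrite toℕ-punchIn x j | skip-≥ (≮⇒≥ j≮x) | skip-≥ (s≤s (≮⇒≥ j≮x)) = refl

skip-≢ : ∀ X j → skip X j ≢ X
skip-≢ X j with j <? X
... | yes j<X = λ eq → <⇒≢ j<X (trans (sym (skip-< j<X)) eq)
... | no  j≮X = λ eq → 1+n≰n (subst (_≤ j) (trans (sym eq) (skip-≥ (≮⇒≥ j≮X))) (≮⇒≥ j≮X))

≤-skip : ∀ X j → j ≤ skip X j
≤-skip X j with j <? X
... | yes j<X = ≤-reflexive (sym (skip-< j<X))
... | no  j≮X = ≤-trans (n≤1+n j) (≤-reflexive (sym (skip-≥ (≮⇒≥ j≮X))))

-- skip X leaves the numbers below X in place and shifts the others up, so it
-- never identifies a number below X with one at or above X.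
straddle : ∀ {X d d′} → d < X → X ≤ d′ → d ≢ suc d′
straddle {d′ = d′} d<X X≤d′ d≡ = <⇒≱ d<X (≤-trans X≤d′ (≤-trans (n≤1+n d′) (≤-reflexive (sym d≡))))

skip-injective : ∀ X d d′ → skip X d ≡ skip X d′ → d ≡ d′
skip-injective X d d′ eq with d <? X | d′ <? X
... | yes d<X | yes d′<X = trans (sym (skip-< d<X)) (trans eq (skip-< d′<X))
... | yes d<X | no  d′≮X = ⊥-elim (straddle d<X (≮⇒≥ d′≮X) (trans (sym (skip-< d<X)) (trans eq (skip-≥ (≮⇒≥ d′≮X)))))
... | no  d≮X | yes d′<X = ⊥-elim (straddle d′<X (≮⇒≥ d≮X) (trans (sym (skip-< d′<X)) (trans (sym eq) (skip-≥ (≮⇒≥ d≮X)))))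
... | no  d≮X | no  d′≮X = suc-injective (trans (sym (skip-≥ (≮⇒≥ d≮X))) (trans eq (skip-≥ (≮⇒≥ d′≮X))))

skip-+ : ∀ m k d → skip (m + k) (m + d) ≡ m + skip k d
skip-+ zero    k d = refl
skip-+ (suc m) k d with m + d <ᵇ m + k | skip-+ m k d
... | true  | eq = cong suc eq
... | false | eq = cong suc eq

module _ {n : ℕ} (S : ℕ → ℕ → Bool) (x : Fin (suc n)) (X : ℕ) (x≡X : toℕ x ≡ X) where

  private
    R : Rel (suc n)
    R = onFin S (suc n)

    toℕ-punchIn′ : ∀ j → toℕ (punchIn x j) ≡ skip X (toℕ j)
    toℕ-punchIn′ j = trans (toℕ-punchIn x j) (cong (λ Y → skip Y (toℕ j)) x≡X)

    from-x : ∀ j → S X (skip X (toℕ j)) ≡ R x (punchIn x j)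
    from-x j = sym (cong₂ S x≡X (toℕ-punchIn′ j))

    to-x : ∀ j → S (skip X (toℕ j)) X ≡ R (punchIn x j) x
    to-x j = sym (cong₂ S (toℕ-punchIn′ j) x≡X)

  E-deleteℕ : ∀ S′ → (∀ i j → S (skip X i) (skip X j) ≡ S′ i j) → E n (Deletion.R∖x R x) ≡ E n (onFin S′ n)
  E-deleteℕ S′ restricts = E-cong (λ i j → trans (cong₂ S (toℕ-punchIn′ i) (toℕ-punchIn′ j)) (restricts (toℕ i) (toℕ j)))

  lastCount-maximalℕ : ∀ S′ → (∀ (j : Fin n) → ¬ T (S X (skip X (toℕ j)))) →
    (∀ i j → S (skip X i) (skip X j) ≡ S′ i j) → Deletion.lastCount R x ≡ E n (onFin S′ n)
  lastCount-maximalℕ S′ maximal restricts =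
    trans (Deletion.lastCount-maximal R x (λ j → maximal j ∘ subst T (sym (from-x j)))) (E-deleteℕ S′ restricts)

  lastCount-nonmaximalℕ : ∀ (j : Fin n) → T (S X (skip X (toℕ j))) → Deletion.lastCount R x ≡ 0
  lastCount-nonmaximalℕ j x<j = Deletion.lastCount-nonmaximal R x j (subst T (from-x j) x<j)

  E-isolatedℕ : ∀ S′ → (∀ (j : Fin n) → ¬ T (S X (skip X (toℕ j)))) → (∀ (j : Fin n) → ¬ T (S (skip X (toℕ j)) X)) →
    (∀ i j → S (skip X i) (skip X j) ≡ S′ i j) → E (suc n) R ≡ suc n * E n (onFin S′ n)
  E-isolatedℕ S′ not-below not-above restricts = trans
    (Deletion.E-isolated R x (λ j → not-below j ∘ subst T (sym (from-x j))) (λ j → not-above j ∘ subst T (sym (to-x j))))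
    (cong (suc n *_) (E-deleteℕ S′ restricts))

-- An interval (l , h) describes a point above the chain elements below l and
-- below the chain elements from h on.
Interval : Set
Interval = ℕ × ℕ

interval : List Interval → ℕ → Interval
interval []       _       = (0 , 0)
interval (I ∷ Is) zero    = I
interval (I ∷ Is) (suc k) = interval Is k

lo hi : List Interval → ℕ → ℕ
lo Is k = proj₁ (interval Is k)
hi Is k = proj₂ (interval Is k)

-- The chain 0 < 1 < … < m - 1, and for the k-th interval of Is the point m + k;
-- distinct points are incomparable.
chainWith : ℕ → List Interval → ℕ → ℕ → Bool
chainWith m Is i j =
  if i <ᵇ m then (if j <ᵇ m then i ≤ᵇ j else i <ᵇ lo Is (j ∸ m))
            else (if j <ᵇ m then hi Is (i ∸ m) ≤ᵇ j else i ≡ᵇ j)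

module _ {m : ℕ} {Is : List Interval} {i j : ℕ} where

  chain-chain : i < m → j < m → chainWith m Is i j ≡ (i ≤ᵇ j)
  chain-chain i<m j<m rewrite <ᵇ-true i<m | <ᵇ-true j<m = refl

  chain-point : i < m → m ≤ j → chainWith m Is i j ≡ (i <ᵇ lo Is (j ∸ m))
  chain-point i<m m≤j rewrite <ᵇ-true i<m | <ᵇ-false m≤j = refl

  point-chain : m ≤ i → j < m → chainWith m Is i j ≡ (hi Is (i ∸ m) ≤ᵇ j)
  point-chain m≤i j<m rewrite <ᵇ-false m≤i | <ᵇ-true j<m = refl

  point-point : m ≤ i → m ≤ j → chainWith m Is i j ≡ (i ≡ᵇ j)
  point-point m≤i m≤j rewrite <ᵇ-false m≤i | <ᵇ-false m≤j = refl

chainCount : (n m : ℕ) → List Interval → ℕ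
chainCount n m Is = E n (onFin (chainWith m Is) n)

chainCount-resize : ∀ {n n′} m Is → n ≡ n′ → chainCount n m Is ≡ chainCount n′ m Is
chainCount-resize m Is = cong (λ N → chainCount N m Is)

-- Deleting the top chain element m cuts every interval at m.
clip : ℕ → List Interval → List Interval
clip m = map (λ I → (proj₁ I , proj₂ I ⊓ m))

interval-clip : ∀ m Is k → interval (clip m Is) k ≡ (lo Is k , hi Is k ⊓ m)
interval-clip m []       k       = refl
interval-clip m (I ∷ Is) zero    = refl
interval-clip m (I ∷ Is) (suc k) = interval-clip m Is k

⊓-below : ∀ h m j → j < m → (h ≤ᵇ j) ≡ (h ⊓ m ≤ᵇ j)
⊓-below h m j j<m with h ≤? m
... | yes h≤m rewrite m≤n⇒m⊓n≡m h≤m = refl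
... | no  h≰m rewrite m≥n⇒m⊓n≡n (<⇒≤ (≰⇒> h≰m)) = trans (≤ᵇ-false (<-trans j<m (≰⇒> h≰m))) (sym (≤ᵇ-false j<m))

chainWith-deleteTop : ∀ m Is i j → chainWith (suc m) Is (skip m i) (skip m j) ≡ chainWith m (clip m Is) i j
chainWith-deleteTop m Is i j with i <? m | j <? m
... | yes i<m | yes j<m
  rewrite skip-< i<m | skip-< j<m | chain-chain {suc m} {Is} (m<n⇒m<1+n i<m) (m<n⇒m<1+n j<m)
        | chain-chain {m} {clip m Is} i<m j<m = refl
... | yes i<m | no j≮m
  rewrite skip-< i<m | skip-≥ (≮⇒≥ j≮m) | chain-point {suc m} {Is} (m<n⇒m<1+n i<m) (s≤s (≮⇒≥ j≮m))
        | chain-point {m} {clip m Is} i<m (≮⇒≥ j≮m) | interval-clip m Is (j ∸ m) = refl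
... | no i≮m | yes j<m
  rewrite skip-≥ (≮⇒≥ i≮m) | skip-< j<m | point-chain {suc m} {Is} (s≤s (≮⇒≥ i≮m)) (m<n⇒m<1+n j<m)
        | point-chain {m} {clip m Is} (≮⇒≥ i≮m) j<m | interval-clip m Is (i ∸ m) = ⊓-below (hi Is (i ∸ m)) m j j<m
... | no i≮m | no j≮m
  rewrite skip-≥ (≮⇒≥ i≮m) | skip-≥ (≮⇒≥ j≮m) | point-point {suc m} {Is} (s≤s (≮⇒≥ i≮m)) (s≤s (≮⇒≥ j≮m))
        | point-point {m} {clip m Is} (≮⇒≥ i≮m) (≮⇒≥ j≮m) = refl

-- Deleting the point m + k deletes the k-th interval.
removeInterval : ℕ → List Interval → List Interval
removeInterval _       []       = []
removeInterval zero    (I ∷ Is) = Is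
removeInterval (suc k) (I ∷ Is) = I ∷ removeInterval k Is

interval-removeInterval : ∀ k Is d → interval (removeInterval k Is) d ≡ interval Is (skip k d)
interval-removeInterval k       []       d       = refl
interval-removeInterval zero    (I ∷ Is) d       = refl
interval-removeInterval (suc k) (I ∷ Is) zero    = refl
interval-removeInterval (suc k) (I ∷ Is) (suc d) with d <ᵇ k | interval-removeInterval k Is d
... | true  | eq = eq
... | false | eq = eq

chainWith-deletePoint : ∀ m k Is i j →
  chainWith m Is (skip (m + k) i) (skip (m + k) j) ≡ chainWith m (removeInterval k Is) i j
chainWith-deletePoint m k Is i j with i <? m | j <? m
... | yes i<m | yes j<m
  rewrite skip-< (≤-trans i<m (m≤m+n m k)) | skip-< (≤-trans j<m (m≤m+n m k))
        | chain-chain {m} {Is} i<m j<m | chain-chain {m} {removeInterval k Is} i<m j<m = refl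
... | yes i<m | no j≮m with m≤n⇒∃[o]m+o≡n (≮⇒≥ j≮m)
...   | d , refl
  rewrite skip-< (≤-trans i<m (m≤m+n m k)) | skip-+ m k d
        | chain-point {m} {Is} i<m (m≤m+n m (skip k d)) | chain-point {m} {removeInterval k Is} i<m (m≤m+n m d)
        | m+n∸m≡n m (skip k d) | m+n∸m≡n m d | interval-removeInterval k Is d = refl
chainWith-deletePoint m k Is i j | no i≮m | yes j<m with m≤n⇒∃[o]m+o≡n (≮⇒≥ i≮m)
...   | d , refl
  rewrite skip-< (≤-trans j<m (m≤m+n m k)) | skip-+ m k d
        | point-chain {m} {Is} (m≤m+n m (skip k d)) j<m | point-chain {m} {removeInterval k Is} (m≤m+n m d) j<m
        | m+n∸m≡n m (skip k d) | m+n∸m≡n m d | interval-removeInterval k Is d = refl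
chainWith-deletePoint m k Is i j | no i≮m | no j≮m with m≤n⇒∃[o]m+o≡n (≮⇒≥ i≮m) | m≤n⇒∃[o]m+o≡n (≮⇒≥ j≮m)
...   | d , refl | d′ , refl
  rewrite skip-+ m k d | skip-+ m k d′
        | point-point {m} {Is} (m≤m+n m (skip k d)) (m≤m+n m (skip k d′))
        | point-point {m} {removeInterval k Is} (m≤m+n m d) (m≤m+n m d′) =
  T-ext (λ t → ≡⇒≡ᵇ _ _ (cong (m +_) (skip-injective k d d′ (+-cancelˡ-≡ m _ _ (≡ᵇ⇒≡ _ _ t)))))
        (λ t → ≡⇒≡ᵇ _ _ (cong (λ e → m + skip k e) (+-cancelˡ-≡ m _ _ (≡ᵇ⇒≡ _ _ t))))

point-above-nothing : ∀ {m Is k} → m ≤ hi Is k → ∀ j → ¬ T (chainWith m Is (m + k) (skip (m + k) j))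
point-above-nothing {m} {Is} {k} m≤hi j with j <? m
... | yes j<m rewrite skip-< (≤-trans j<m (m≤m+n m k)) | point-chain {m} {Is} (m≤m+n m k) j<m | m+n∸m≡n m k =
  λ t → <⇒≱ j<m (≤-trans m≤hi (≤ᵇ⇒≤ _ _ t))
... | no  j≮m rewrite point-point {m} {Is} (m≤m+n m k) (≤-trans (≮⇒≥ j≮m) (≤-skip (m + k) j)) =
  λ t → skip-≢ (m + k) j (sym (≡ᵇ⇒≡ _ _ t))

point-below-nothing : ∀ {m Is k} → lo Is k ≡ 0 → ∀ j → ¬ T (chainWith m Is (skip (m + k) j) (m + k))
point-below-nothing {m} {Is} {k} lo≡0 j with j <? m
... | yes j<m rewrite skip-< (≤-trans j<m (m≤m+n m k)) | chain-point {m} {Is} j<m (m≤m+n m k) | m+n∸m≡n m k | lo≡0 = λ ()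
... | no  j≮m rewrite point-point {m} {Is} (≤-trans (≮⇒≥ j≮m) (≤-skip (m + k) j)) (m≤m+n m k) =
  λ t → skip-≢ (m + k) j (≡ᵇ⇒≡ _ _ t)

data Side (m i : ℕ) : Set where
  inChain : i < m → Side m i
  atPoint : m ≤ i → Side m i

side : ∀ m i → Side m i
side m i with i <? m
... | yes i<m = inChain i<m
... | no  i≮m = atPoint (≮⇒≥ i≮m)

-- chainWith m Is is a partial order on {0, …, N − 1} when every interval is
-- non-empty and any two intervals of points present overlap (otherwise a
-- chain element would lie between two points).
module ChainPoset (m : ℕ) (Is : List Interval) (N : ℕ)
                  (lo≤hi : ∀ k → lo Is k ≤ hi Is k)
                  (overlapping : ∀ k k′ → m + k < N → m + k′ < N → lo Is k′ ≤ hi Is k) where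

  private
    R : ℕ → ℕ → Bool
    R = chainWith m Is

  module _ {i j : ℕ} where

    ⇔-chain-chain : i < m → j < m → T (R i j) ⇔ i ≤ j
    ⇔-chain-chain i<m j<m rewrite chain-chain {m} {Is} i<m j<m = mk⇔ (≤ᵇ⇒≤ i j) ≤⇒≤ᵇ

    ⇔-chain-point : i < m → m ≤ j → T (R i j) ⇔ i < lo Is (j ∸ m)
    ⇔-chain-point i<m m≤j rewrite chain-point {m} {Is} i<m m≤j = mk⇔ (<ᵇ⇒< i _) <⇒<ᵇ

    ⇔-point-chain : m ≤ i → j < m → T (R i j) ⇔ hi Is (i ∸ m) ≤ j
    ⇔-point-chain m≤i j<m rewrite point-chain {m} {Is} m≤i j<m = mk⇔ (≤ᵇ⇒≤ _ j) ≤⇒≤ᵇ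

    ⇔-point-point : m ≤ i → m ≤ j → T (R i j) ⇔ i ≡ j
    ⇔-point-point m≤i m≤j rewrite point-point {m} {Is} m≤i m≤j = mk⇔ (≡ᵇ⇒≡ i j) (≡⇒≡ᵇ i j)

  reflexive : ∀ i → T (R i i)
  reflexive i with side m i
  ... | inChain i<m = from (⇔-chain-chain i<m i<m) ≤-refl
  ... | atPoint m≤i = from (⇔-point-point m≤i m≤i) refl

  antisymmetric : ∀ i j → T (R i j) → T (R j i) → i ≡ j
  antisymmetric i j ij ji with side m i | side m j
  ... | inChain i<m | inChain j<m = ≤-antisym (to (⇔-chain-chain i<m j<m) ij) (to (⇔-chain-chain j<m i<m) ji)
  ... | inChain i<m | atPoint m≤j =
    ⊥-elim (<⇒≱ (to (⇔-chain-point i<m m≤j) ij) (≤-trans (lo≤hi (j ∸ m)) (to (⇔-point-chain m≤j i<m) ji)))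
  ... | atPoint m≤i | inChain j<m =
    ⊥-elim (<⇒≱ (to (⇔-chain-point j<m m≤i) ji) (≤-trans (lo≤hi (i ∸ m)) (to (⇔-point-chain m≤i j<m) ij)))
  ... | atPoint m≤i | atPoint m≤j = to (⇔-point-point m≤i m≤j) ij

  transitive : ∀ i j l → i < N → l < N → T (R i j) → T (R j l) → T (R i l)
  transitive i j l i<N l<N ij jl with side m i | side m j | side m l
  ... | inChain i<m | inChain j<m | inChain l<m =
    from (⇔-chain-chain i<m l<m) (≤-trans (to (⇔-chain-chain i<m j<m) ij) (to (⇔-chain-chain j<m l<m) jl))
  ... | inChain i<m | inChain j<m | atPoint m≤l =
    from (⇔-chain-point i<m m≤l) (≤-<-trans (to (⇔-chain-chain i<m j<m) ij) (to (⇔-chain-point j<m m≤l) jl))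
  ... | inChain i<m | atPoint m≤j | inChain l<m =
    from (⇔-chain-chain i<m l<m) (≤-trans (<⇒≤ (to (⇔-chain-point i<m m≤j) ij))
                                          (≤-trans (lo≤hi (j ∸ m)) (to (⇔-point-chain m≤j l<m) jl)))
  ... | _           | atPoint m≤j | atPoint m≤l = subst (T ∘ R i) (to (⇔-point-point m≤j m≤l) jl) ij
  ... | atPoint m≤i | inChain j<m | inChain l<m =
    from (⇔-point-chain m≤i l<m) (≤-trans (to (⇔-point-chain m≤i j<m) ij) (to (⇔-chain-chain j<m l<m) jl))
  ... | atPoint m≤i | inChain j<m | atPoint m≤l =
    ⊥-elim (<⇒≱ (≤-<-trans (to (⇔-point-chain m≤i j<m) ij) (to (⇔-chain-point j<m m≤l) jl))
                (overlapping (i ∸ m) (l ∸ m) (subst (_< N) (sym (m+[n∸m]≡n m≤i)) i<N)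
                                            (subst (_< N) (sym (m+[n∸m]≡n m≤l)) l<N)))
  ... | atPoint m≤i | atPoint m≤j | inChain l<m = subst (λ z → T (R z l)) (sym (to (⇔-point-point m≤i m≤j) ij)) jl

  poset : FinPoset
  poset = record
    { size     = N
    ; leq      = onFin R N
    ; refl'    = λ x → to T-≡ (reflexive (toℕ x))
    ; antisym' = λ x y xy yx → toℕ-injective (antisymmetric (toℕ x) (toℕ y) (from T-≡ xy) (from T-≡ yx))
    ; trans'   = λ x y z xy yz →
        to T-≡ (transitive (toℕ x) (toℕ y) (toℕ z) (toℕ<n x) (toℕ<n z) (from T-≡ xy) (from T-≡ yz))
    }

-- The last element of a linear extension of chainWith (suc m) Is on
-- suc (m + length Is) elements is the top chain element m or a point
-- suc m + k; each is last in the extensions of the rest if it is maximal, and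
-- in none otherwise.
lastOf : (n m : ℕ) → List Interval → Fin (suc n) → ℕ
lastOf n m Is = Deletion.lastCount (onFin (chainWith m Is) (suc n))

module TopOfChain (m : ℕ) (Is : List Interval) where

  t n : ℕ
  t = length Is
  n = m + t

  top : Fin (suc n)
  top = fromℕ m ↑ˡ t

  point : Fin t → Fin (suc n)
  point k = suc m ↑ʳ k

  byLast : chainCount (suc n) (suc m) Is ≡ lastOf n (suc m) Is top + ∑[ k < t ] lastOf n (suc m) Is (point k)
  byLast = begin
    chainCount (suc n) (suc m) Is
      ≡⟨ E-byLast n _ ⟩
    ∑[ x < suc n ] lastOf n (suc m) Is x
      ≡⟨ ∑-↑ {suc m} {t} (lastOf n (suc m) Is) ⟩
    ∑[ i < suc m ] lastOf n (suc m) Is (i ↑ˡ t) + ∑[ k < t ] lastOf n (suc m) Is (point k)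
      ≡⟨ cong (_+ ∑[ k < t ] lastOf n (suc m) Is (point k)) (∑-last (λ i → lastOf n (suc m) Is (i ↑ˡ t)) below-top) ⟩
    lastOf n (suc m) Is top + ∑[ k < t ] lastOf n (suc m) Is (point k) ∎
    where
    open ≡-Reasoning
    -- chain elements other than the top are below their successor
    below-top : ∀ i → toℕ i < m → lastOf n (suc m) Is (i ↑ˡ t) ≡ 0
    below-top i i<m = lastCount-nonmaximalℕ (chainWith (suc m) Is) (i ↑ˡ t) (toℕ i) (toℕ-↑ˡ i t) j i<next
      where
      j : Fin n
      j = fromℕ< (<-≤-trans i<m (m≤m+n m t))
      i<next : T (chainWith (suc m) Is (toℕ i) (skip (toℕ i) (toℕ j)))
      i<next rewrite toℕ-fromℕ< (<-≤-trans i<m (m≤m+n m t)) | skip-≥ {toℕ i} {toℕ i} ≤-refl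
                   | chain-chain {suc m} {Is} (m<n⇒m<1+n i<m) (s<s i<m) = ≤⇒≤ᵇ (n≤1+n (toℕ i))

  toℕ-top : toℕ top ≡ m
  toℕ-top = trans (toℕ-↑ˡ (fromℕ m) t) (toℕ-fromℕ m)

  top-maximal : (∀ k → lo Is k ≤ m) → lastOf n (suc m) Is top ≡ chainCount n m (clip m Is)
  top-maximal lo≤m = lastCount-maximalℕ (chainWith (suc m) Is) top m toℕ-top _ maximal (chainWith-deleteTop m Is)
    where
    maximal : ∀ (j : Fin n) → ¬ T (chainWith (suc m) Is m (skip m (toℕ j)))
    maximal j with toℕ j <? m
    ... | yes j<m rewrite skip-< j<m | chain-chain {suc m} {Is} (n<1+n m) (m<n⇒m<1+n j<m) = <⇒≱ j<m ∘ ≤ᵇ⇒≤ m (toℕ j)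
    ... | no  j≮m rewrite skip-≥ (≮⇒≥ j≮m) | chain-point {suc m} {Is} (n<1+n m) (s≤s (≮⇒≥ j≮m)) =
      λ t → <⇒≱ (<ᵇ⇒< m _ t) (lo≤m (toℕ j ∸ m))

  top-nonmaximal : ∀ k → k < t → lo Is k ≡ suc m → lastOf n (suc m) Is top ≡ 0
  top-nonmaximal k k<t lo≡1+m = lastCount-nonmaximalℕ (chainWith (suc m) Is) top m toℕ-top j top<point
    where
    j : Fin n
    j = fromℕ< (+-monoʳ-< m k<t)
    top<point : T (chainWith (suc m) Is m (skip m (toℕ j)))
    top<point rewrite toℕ-fromℕ< (+-monoʳ-< m k<t) | skip-≥ (m≤m+n m k)
                    | chain-point {suc m} {Is} (n<1+n m) (s≤s (m≤m+n m k)) | m+n∸m≡n m k | lo≡1+m = <⇒<ᵇ (n<1+n m)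

  point-maximal : ∀ k → hi Is (toℕ k) ≡ suc m → lastOf n (suc m) Is (point k) ≡ chainCount n (suc m) (removeInterval (toℕ k) Is)
  point-maximal k hi≡1+m = lastCount-maximalℕ (chainWith (suc m) Is) (point k) (suc m + toℕ k) (toℕ-↑ʳ (suc m) k) _
    (point-above-nothing {suc m} {Is} (≤-reflexive (sym hi≡1+m)) ∘ toℕ) (chainWith-deletePoint (suc m) (toℕ k) Is)

  point-nonmaximal : ∀ k → hi Is (toℕ k) ≤ m → lastOf n (suc m) Is (point k) ≡ 0
  point-nonmaximal k hi≤m = lastCount-nonmaximalℕ (chainWith (suc m) Is) (point k) (suc m + toℕ k) (toℕ-↑ʳ (suc m) k)
    (fromℕ< hi<n) point<hi
    where
    hi<n : hi Is (toℕ k) < n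
    hi<n = ≤-<-trans hi≤m (m<m+n m (≤-<-trans z≤n (toℕ<n k)))
    point<hi : T (chainWith (suc m) Is (suc m + toℕ k) (skip (suc m + toℕ k) (toℕ (fromℕ< hi<n))))
    point<hi rewrite toℕ-fromℕ< hi<n | skip-< (≤-trans (s≤s hi≤m) (m≤m+n (suc m) (toℕ k)))
                   | point-chain {suc m} {Is} (m≤m+n (suc m) (toℕ k)) (s≤s hi≤m) | m+n∸m≡n (suc m) (toℕ k) =
      ≤⇒≤ᵇ (≤-refl {hi Is (toℕ k)})

-- The expected counts: a point with interval (l , h) has slots l h possible
-- positions in the chain; two points have pairCount positions, the common
-- slots being counted twice because there both orders of the points occur.
slots : ℕ → ℕ → ℕ
slots l h = suc (h ∸ l)

common : ℕ → ℕ → ℕ → ℕ → ℕ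
common lx hx ly hy = suc (hx ⊓ hy) ∸ (lx ⊔ ly)

pairCount : ℕ → ℕ → ℕ → ℕ → ℕ
pairCount lx hx ly hy = slots lx hx * slots ly hy + common lx hx ly hy

-- How a point with interval (l , h) ⊆ [0, suc m] relates to the top chain
-- element m: below it, incomparable to it, or above it.
data Reach (m l h : ℕ) : Set where
  below   : h ≤ m → Reach m l h
  touches : l ≤ m → h ≡ suc m → Reach m l h
  above   : l ≡ suc m → h ≡ suc m → Reach m l h

reach : ∀ m l h → l ≤ h → h ≤ suc m → Reach m l h
reach m l h l≤h h≤1+m with h ≤? m | l ≤? m
... | yes h≤m | _       = below h≤m
... | no  h≰m | yes l≤m = touches l≤m (≤-antisym h≤1+m (≰⇒> h≰m))
... | no  h≰m | no  l≰m = above (≤-antisym (≤-trans l≤h h≤1+m) (≰⇒> l≰m)) (≤-antisym h≤1+m (≰⇒> h≰m))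

-- The contributions to the count of the extensions ending with a point (the
-- count `rest` of the others, if the point can be last) and ending with the top
-- chain element (the count one level down, if no point is above it).
pointTerm : ∀ {m l h} → Reach m l h → ℕ → ℕ
pointTerm (below _)     _    = 0
pointTerm (touches _ _) rest = rest
pointTerm (above _ _)   rest = rest

topTerm₁ : ∀ {m l h} → Reach m l h → ℕ
topTerm₁ {m} {l} {h} (below _)     = slots l (h ⊓ m)
topTerm₁ {m} {l} {h} (touches _ _) = slots l (h ⊓ m)
topTerm₁             (above _ _)   = 0

topTerm₂ : ∀ {m lx hx ly hy} → Reach m lx hx → Reach m ly hy → ℕ
topTerm₂ (above _ _)   _           = 0
topTerm₂ (below _)     (above _ _) = 0
topTerm₂ (touches _ _) (above _ _) = 0
topTerm₂ {m} {lx} {hx} {ly} {hy} (below _)     (below _)     = pairCount lx (hx ⊓ m) ly (hy ⊓ m)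
topTerm₂ {m} {lx} {hx} {ly} {hy} (below _)     (touches _ _) = pairCount lx (hx ⊓ m) ly (hy ⊓ m)
topTerm₂ {m} {lx} {hx} {ly} {hy} (touches _ _) (below _)     = pairCount lx (hx ⊓ m) ly (hy ⊓ m)
topTerm₂ {m} {lx} {hx} {ly} {hy} (touches _ _) (touches _ _) = pairCount lx (hx ⊓ m) ly (hy ⊓ m)

1+m⊓m : ∀ m → suc m ⊓ m ≡ m
1+m⊓m m = m≥n⇒m⊓n≡n (n≤1+n m)

slots-suc : ∀ {l m} → l ≤ m → slots l (suc m) ≡ suc (slots l m)
slots-suc l≤m = cong suc (+-∸-assoc 1 l≤m)

slots-top : ∀ {m l h} (v : Reach m l h) → topTerm₁ v + (pointTerm v 1 + 0) ≡ slots l h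
slots-top {m} (below h≤m)        rewrite m≤n⇒m⊓n≡m h≤m = +-identityʳ _
slots-top {m} (touches l≤m refl) rewrite 1+m⊓m m | slots-suc l≤m = +-comm _ 1
slots-top {m} (above refl refl)  rewrite n∸n≡0 m = refl

grow-x : ∀ a b c → a * b + c + (b + 0) ≡ suc a * b + c
grow-x = solve-∀

grow-y : ∀ a b c → a * b + c + (0 + (a + 0)) ≡ a * suc b + c
grow-y = solve-∀

grow-xy : ∀ a b c → a * b + c + (suc b + (suc a + 0)) ≡ suc a * suc b + suc c
grow-xy = solve-∀

only-y : ∀ b → 0 + (b + (0 + 0)) ≡ 1 * b + 0
only-y = solve-∀

only-x : ∀ a → 0 + (0 + (a + 0)) ≡ a * 1 + 0
only-x = solve-∀

with-top-y : ∀ b → 0 + (b + (1 + 0)) ≡ 1 * b + 1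
with-top-y = solve-∀

with-top-x : ∀ a → 0 + (1 + (a + 0)) ≡ a * 1 + 1
with-top-x = solve-∀

pairCount-top : ∀ {m lx hx ly hy} (vx : Reach m lx hx) (vy : Reach m ly hy) → lx ≤ hx → ly ≤ hy →
                topTerm₂ vx vy + (pointTerm vx (slots ly hy) + (pointTerm vy (slots lx hx) + 0))
                  ≡ pairCount lx hx ly hy
pairCount-top {m} (below hx≤m) (below hy≤m) _ _
  rewrite m≤n⇒m⊓n≡m hx≤m | m≤n⇒m⊓n≡m hy≤m = +-identityʳ _
pairCount-top {m} {lx} {ly = ly} {hy} (touches lx≤m refl) (below hy≤m) _ _
  rewrite 1+m⊓m m | m≤n⇒m⊓n≡m hy≤m | m≥n⇒m⊓n≡n (≤-trans hy≤m (n≤1+n m)) | m≥n⇒m⊓n≡n hy≤m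
        | +-∸-assoc 1 lx≤m = grow-x (suc (m ∸ lx)) (suc (hy ∸ ly)) (suc hy ∸ (lx ⊔ ly))
pairCount-top {m} {lx} {hx} {ly} (below hx≤m) (touches ly≤m refl) _ _
  rewrite 1+m⊓m m | m≤n⇒m⊓n≡m hx≤m | m≤n⇒m⊓n≡m (≤-trans hx≤m (n≤1+n m)) | m≤n⇒m⊓n≡m hx≤m
        | +-∸-assoc 1 ly≤m = grow-y (suc (hx ∸ lx)) (suc (m ∸ ly)) (suc hx ∸ (lx ⊔ ly))
pairCount-top {m} {lx} {ly = ly} (touches lx≤m refl) (touches ly≤m refl) _ _
  rewrite 1+m⊓m m | ⊓-idem m | +-∸-assoc 1 (⊔-lub lx≤m ly≤m) | +-∸-assoc 2 (⊔-lub lx≤m ly≤m)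
        | +-∸-assoc 1 lx≤m | +-∸-assoc 1 ly≤m = grow-xy (suc (m ∸ lx)) (suc (m ∸ ly)) (suc (m ∸ (lx ⊔ ly)))
pairCount-top {m} {ly = ly} {hy} (above refl refl) (below hy≤m) _ ly≤hy
  rewrite n∸n≡0 m | m≥n⇒m⊓n≡n (≤-trans hy≤m (n≤1+n m)) | m≥n⇒m⊔n≡m (≤-trans ly≤hy (≤-trans hy≤m (n≤1+n m)))
        | m≤n⇒m∸n≡0 hy≤m = only-y (suc (hy ∸ ly))
pairCount-top {m} {lx} {hx} (below hx≤m) (above refl refl) lx≤hx _
  rewrite n∸n≡0 m | m≤n⇒m⊓n≡m (≤-trans hx≤m (n≤1+n m)) | m≤n⇒m⊔n≡n (≤-trans lx≤hx (≤-trans hx≤m (n≤1+n m)))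
        | m≤n⇒m∸n≡0 hx≤m = only-x (suc (hx ∸ lx))
pairCount-top {m} {ly = ly} (above refl refl) (touches ly≤m refl) _ _
  rewrite n∸n≡0 m | ⊓-idem m | m≥n⇒m⊔n≡m (≤-trans ly≤m (n≤1+n m)) | m+n∸n≡m 1 m = with-top-y (suc (suc m ∸ ly))
pairCount-top {m} {lx} (touches lx≤m refl) (above refl refl) _ _
  rewrite n∸n≡0 m | ⊓-idem m | m≤n⇒m⊔n≡n (≤-trans lx≤m (n≤1+n m)) | m+n∸n≡m 1 m = with-top-x (suc (suc m ∸ lx))
pairCount-top {m} (above refl refl) (above refl refl) _ _
  rewrite n∸n≡0 m | ⊓-idem m | ⊔-idem m | m+n∸n≡m 1 m = refl

-- The counts, by induction on the chain length m: the last element of an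
-- extension is the top chain element or a point reaching the top.
chainCount-empty : ∀ m → chainCount (m + 0) m [] ≡ 1
chainCount-empty zero    = refl
chainCount-empty (suc m) =
  trans (TopOfChain.byLast m [])
        (trans (+-identityʳ _) (trans (TopOfChain.top-maximal m [] (λ _ → z≤n)) (chainCount-empty m)))

module OnePointStep (m l h : ℕ) (l≤h : l ≤ h) (h≤1+m : h ≤ suc m)
                    (smaller : ∀ h′ → l ≤ h′ → h′ ≤ m → chainCount (m + 1) m ((l , h′) ∷ []) ≡ slots l h′) where

  Is : List Interval
  Is = (l , h) ∷ []
  open TopOfChain m Is using (top; point; byLast; top-maximal; top-nonmaximal; point-maximal; point-nonmaximal)

  lo≤ : l ≤ m → ∀ k → lo Is k ≤ m
  lo≤ l≤m zero    = l≤m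
  lo≤ l≤m (suc k) = z≤n

  top-value : (v : Reach m l h) → lastOf (m + 1) (suc m) Is top ≡ topTerm₁ v
  top-value (below h≤m)        = trans (top-maximal (lo≤ (≤-trans l≤h h≤m)))
                                       (smaller (h ⊓ m) (⊓-glb l≤h (≤-trans l≤h h≤m)) (m⊓n≤n h m))
  top-value (touches l≤m refl) = trans (top-maximal (lo≤ l≤m)) (smaller (suc m ⊓ m) (⊓-glb l≤h l≤m) (m⊓n≤n (suc m) m))
  top-value (above l≡1+m _)    = top-nonmaximal 0 z<s l≡1+m

  reaching : h ≡ suc m → lastOf (m + 1) (suc m) Is (point zero) ≡ 1
  reaching h≡1+m =
    trans (point-maximal zero h≡1+m) (trans (chainCount-resize (suc m) [] (+-suc m 0)) (chainCount-empty (suc m)))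

  point-value : (v : Reach m l h) → lastOf (m + 1) (suc m) Is (point zero) ≡ pointTerm v 1
  point-value (below h≤m)    = point-nonmaximal zero h≤m
  point-value (touches _ h≡) = reaching h≡
  point-value (above _ h≡)   = reaching h≡

  count : chainCount (suc m + 1) (suc m) Is ≡ slots l h
  count = begin
    chainCount (suc m + 1) (suc m) Is
      ≡⟨ byLast ⟩
    lastOf (m + 1) (suc m) Is top + (lastOf (m + 1) (suc m) Is (point zero) + 0)
      ≡⟨ cong₂ (λ a b → a + (b + 0)) (top-value v) (point-value v) ⟩
    topTerm₁ v + (pointTerm v 1 + 0)
      ≡⟨ slots-top v ⟩
    slots l h ∎
    where
    open ≡-Reasoning
    v : Reach m l h
    v = reach m l h l≤h h≤1+m

chainCount-one : ∀ m l h → l ≤ h → h ≤ m → chainCount (m + 1) m ((l , h) ∷ []) ≡ slots l h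
chainCount-one zero    .zero .zero z≤n z≤n = refl
chainCount-one (suc m) l    h    l≤h h≤1+m = OnePointStep.count m l h l≤h h≤1+m (chainCount-one m l)

module TwoPointStep (m lx hx ly hy : ℕ) (lx≤hx : lx ≤ hx) (hx≤1+m : hx ≤ suc m) (ly≤hy : ly ≤ hy) (hy≤1+m : hy ≤ suc m)
                    (smaller : ∀ hx′ hy′ → lx ≤ hx′ → hx′ ≤ m → ly ≤ hy′ → hy′ ≤ m →
                               chainCount (m + 2) m ((lx , hx′) ∷ (ly , hy′) ∷ []) ≡ pairCount lx hx′ ly hy′) where

  Is : List Interval
  Is = (lx , hx) ∷ (ly , hy) ∷ []
  open TopOfChain m Is using (top; point; byLast; top-maximal; top-nonmaximal; point-maximal; point-nonmaximal)

  top-generic : lx ≤ m → ly ≤ m → lastOf (m + 2) (suc m) Is top ≡ pairCount lx (hx ⊓ m) ly (hy ⊓ m)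
  top-generic lx≤m ly≤m = trans (top-maximal lo≤m)
    (smaller (hx ⊓ m) (hy ⊓ m) (⊓-glb lx≤hx lx≤m) (m⊓n≤n hx m) (⊓-glb ly≤hy ly≤m) (m⊓n≤n hy m))
    where
    lo≤m : ∀ k → lo Is k ≤ m
    lo≤m 0             = lx≤m
    lo≤m 1             = ly≤m
    lo≤m (suc (suc k)) = z≤n

  top-value : (vx : Reach m lx hx) (vy : Reach m ly hy) → lastOf (m + 2) (suc m) Is top ≡ topTerm₂ vx vy
  top-value (above lx≡1+m _) _                = top-nonmaximal 0 z<s lx≡1+m
  top-value (below _)        (above ly≡1+m _) = top-nonmaximal 1 (s<s z<s) ly≡1+m
  top-value (touches _ _)    (above ly≡1+m _) = top-nonmaximal 1 (s<s z<s) ly≡1+m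
  top-value (below hx≤m)     (below hy≤m)     = top-generic (≤-trans lx≤hx hx≤m) (≤-trans ly≤hy hy≤m)
  top-value (below hx≤m)     (touches ly≤m _) = top-generic (≤-trans lx≤hx hx≤m) ly≤m
  top-value (touches lx≤m _) (below hy≤m)     = top-generic lx≤m (≤-trans ly≤hy hy≤m)
  top-value (touches lx≤m _) (touches ly≤m _) = top-generic lx≤m ly≤m

  x-reaching : hx ≡ suc m → lastOf (m + 2) (suc m) Is (point zero) ≡ slots ly hy
  x-reaching hx≡1+m = trans (point-maximal zero hx≡1+m)
    (trans (chainCount-resize (suc m) ((ly , hy) ∷ []) (+-suc m 1)) (chainCount-one (suc m) ly hy ly≤hy hy≤1+m))

  y-reaching : hy ≡ suc m → lastOf (m + 2) (suc m) Is (point (suc zero)) ≡ slots lx hx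
  y-reaching hy≡1+m = trans (point-maximal (suc zero) hy≡1+m)
    (trans (chainCount-resize (suc m) ((lx , hx) ∷ []) (+-suc m 1)) (chainCount-one (suc m) lx hx lx≤hx hx≤1+m))

  x-value : (vx : Reach m lx hx) → lastOf (m + 2) (suc m) Is (point zero) ≡ pointTerm vx (slots ly hy)
  x-value (below hx≤m)    = point-nonmaximal zero hx≤m
  x-value (touches _ hx≡) = x-reaching hx≡
  x-value (above _ hx≡)   = x-reaching hx≡

  y-value : (vy : Reach m ly hy) → lastOf (m + 2) (suc m) Is (point (suc zero)) ≡ pointTerm vy (slots lx hx)
  y-value (below hy≤m)    = point-nonmaximal (suc zero) hy≤m
  y-value (touches _ hy≡) = y-reaching hy≡
  y-value (above _ hy≡)   = y-reaching hy≡

  count : chainCount (suc m + 2) (suc m) Is ≡ pairCount lx hx ly hy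
  count = begin
    chainCount (suc m + 2) (suc m) Is
      ≡⟨ byLast ⟩
    lastOf (m + 2) (suc m) Is top + (lastOf (m + 2) (suc m) Is (point zero) + (lastOf (m + 2) (suc m) Is (point (suc zero)) + 0))
      ≡⟨ cong₂ _+_ (top-value vx vy) (cong₂ (λ a b → a + (b + 0)) (x-value vx) (y-value vy)) ⟩
    topTerm₂ vx vy + (pointTerm vx (slots ly hy) + (pointTerm vy (slots lx hx) + 0))
      ≡⟨ pairCount-top vx vy lx≤hx ly≤hy ⟩
    pairCount lx hx ly hy ∎
    where
    open ≡-Reasoning
    vx : Reach m lx hx
    vx = reach m lx hx lx≤hx hx≤1+m
    vy : Reach m ly hy
    vy = reach m ly hy ly≤hy hy≤1+m

chainCount-two : ∀ m lx hx ly hy → lx ≤ hx → hx ≤ m → ly ≤ hy → hy ≤ m →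
                 chainCount (m + 2) m ((lx , hx) ∷ (ly , hy) ∷ []) ≡ pairCount lx hx ly hy
chainCount-two zero    .zero .zero .zero .zero z≤n z≤n z≤n z≤n = refl
chainCount-two (suc m) lx    hx    ly    hy    lx≤hx hx≤1+m ly≤hy hy≤1+m =
  TwoPointStep.count m lx hx ly hy lx≤hx hx≤1+m ly≤hy hy≤1+m (λ hx′ hy′ → chainCount-two m lx hx′ ly hy′)

sqrtRem : ∀ b → ∃₂ λ s t → b ≡ s * s + t × t ≤ 2 * s
sqrtRem zero = 0 , 0 , refl , z≤n
sqrtRem (suc b) with sqrtRem b
... | s , t , b≡ , t≤2s with t <? 2 * s
...   | yes t<2s = s , suc t , trans (cong suc b≡) (sym (+-suc (s * s) t)) , t<2s
...   | no  t≮2s = suc s , 0 , trans (cong suc b≡) (trans (cong (λ r → suc (s * s + r)) t≡2s) (square-suc s)) , z≤n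
  where
  t≡2s : t ≡ 2 * s
  t≡2s = ≤-antisym t≤2s (≮⇒≥ t≮2s)
  square-suc : ∀ s → suc (s * s + 2 * s) ≡ suc s * suc s + 0
  square-suc = solve-∀

record Decomposition (a b : ℕ) : Set where
  field
    u o v : ℕ
    fits  : u + o + v + 3 ≤ a
    value : b ≡ (u + suc o) * (suc o + v) + suc o

-- Writing b = s² + t with 0 ≤ t ≤ 2s (where 2s < a): for t = 0 take
-- (s−1)(s+1) + 1, for 1 ≤ t ≤ s take s·s + t, and for t = s + t′ + 1 take
-- s(s+1) + (t′+1).
perfectSquare : ∀ a s → 2 * (2 + s) < a → Decomposition a ((2 + s) * (2 + s) + 0)
perfectSquare a s 2s<a = record
  { u = s ; o = 0 ; v = 2 + s
  ; fits  = ≤-trans (≤-reflexive (width s)) 2s<a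
  ; value = square s
  }
  where
  width : ∀ s → s + 0 + (2 + s) + 3 ≡ suc (2 * (2 + s))
  width = solve-∀
  square : ∀ s → (2 + s) * (2 + s) + 0 ≡ (s + 1) * (1 + (2 + s)) + 1
  square = solve-∀

smallRemainder : ∀ a w o → 2 * (suc o + w) < a → Decomposition a ((suc o + w) * (suc o + w) + suc o)
smallRemainder a w o 2s<a = record
  { u = w ; o = o ; v = w
  ; fits  = ≤-trans (m≤m+n (w + o + w + 3) o) (≤-trans (≤-reflexive (width o w)) 2s<a)
  ; value = square o w
  }
  where
  width : ∀ o w → w + o + w + 3 + o ≡ suc (2 * (suc o + w))
  width = solve-∀
  square : ∀ o w → (suc o + w) * (suc o + w) + suc o ≡ (w + suc o) * (suc o + w) + suc o
  square = solve-∀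

-- For t′ = 0 this needs 2s + 2 ≤ a, and a = 2s + 1 would give a² < 4b.
largeRemainder : ∀ a w t → 2 * (suc t + w) < a →
                 4 * ((suc t + w) * (suc t + w) + suc (suc t + w + t)) < a * a →
                 Decomposition a ((suc t + w) * (suc t + w) + suc (suc t + w + t))
largeRemainder a w t 2s<a 4b<a² = record
  { u = w ; o = t ; v = suc w
  ; fits  = fits t 2s<a 4b<a²
  ; value = square t w
  }
  where
  square : ∀ t w → (suc t + w) * (suc t + w) + suc (suc t + w + t) ≡ (w + suc t) * (suc t + suc w) + suc t
  square = solve-∀
  fits : ∀ t → 2 * (suc t + w) < a → 4 * ((suc t + w) * (suc t + w) + suc (suc t + w + t)) < a * a →
         w + t + suc w + 3 ≤ a
  fits (suc t) 2s<a _ = ≤-trans (m≤m+n _ t) (≤-trans (≤-reflexive (width t w)) 2s<a)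
    where
    width : ∀ t w → w + suc t + suc w + 3 + t ≡ suc (2 * (suc (suc t) + w))
    width = solve-∀
  fits zero 2s<a 4b<a² with suc (2 * suc w) <? a
  ... | yes 2s+1<a = ≤-trans (≤-reflexive (width w)) 2s+1<a
    where
    width : ∀ w → w + 0 + suc w + 3 ≡ suc (suc (2 * suc w))
    width = solve-∀
  ... | no  2s+1≮a = ⊥-elim (<⇒≱ 4b<a² (≤-trans (≤-reflexive (cong (λ z → z * z) a≡2s+1))
                                            (≤-trans (m≤m+n _ 3) (≤-reflexive (odd-square w)))))
    where
    a≡2s+1 : a ≡ suc (2 * suc w)
    a≡2s+1 = ≤-antisym (≮⇒≥ 2s+1≮a) 2s<a
    odd-square : ∀ w → suc (2 * suc w) * suc (2 * suc w) + 3 ≡ 4 * ((1 + w) * (1 + w) + suc (1 + w + 0))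
    odd-square = solve-∀

remainder-bound : ∀ s t → suc (s + t) ≤ 2 * s → suc t ≤ s
remainder-bound s t h =
  +-cancelˡ-≤ s (suc t) s (≤-trans (≤-reflexive (+-suc s t)) (≤-trans h (≤-reflexive (cong (s +_) (+-identityʳ s)))))

-- The case analysis on the remainder (s ≤ 1 contradicts 4 < a ≤ b).
byRemainder : ∀ a s t → t ≤ 2 * s → 2 * s < a → 4 * (s * s + t) < a * a → a ≤ s * s + t → 4 < a →
              Decomposition a (s * s + t)
byRemainder a 0             0       _    _    _     a≤b 4<a = ⊥-elim (<⇒≱ (≤-trans 4<a a≤b) z≤n)
byRemainder a 1             0       _    _    _     a≤b 4<a = ⊥-elim (<⇒≱ (≤-trans 4<a a≤b) (s≤s z≤n))
byRemainder a (suc (suc s)) 0       _    2s<a _     _   _   = perfectSquare a s 2s<a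
byRemainder a s             (suc o) t≤2s 2s<a 4b<a² _   _   with suc o ≤? s
... | yes o<s with m≤n⇒∃[o]m+o≡n o<s
...   | w , refl = smallRemainder a w o 2s<a
byRemainder a s (suc o) t≤2s 2s<a 4b<a² _ _ | no o≮s with m≤n⇒∃[o]m+o≡n (≮⇒≥ o≮s)
...   | t , refl with m≤n⇒∃[o]m+o≡n (remainder-bound s t t≤2s)
...     | w , refl = largeRemainder a w t 2s<a 4b<a²

decompose : ∀ a b → 4 * b < a * a → a ≤ b → Decomposition a b
decompose a b 4b<a² a≤b with sqrtRem b
... | s , t , refl , t≤2s = byRemainder a s t t≤2s 2s<a 4b<a² a≤b 4<a
  where
  2s<a : 2 * s < a
  2s<a = ≰⇒> λ a≤2s → <⇒≱ 4b<a² (begin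
    a * a             ≤⟨ *-mono-≤ a≤2s a≤2s ⟩
    2 * s * (2 * s)   ≡⟨ four-squares s ⟩
    4 * (s * s)       ≤⟨ *-monoʳ-≤ 4 (m≤m+n (s * s) t) ⟩
    4 * (s * s + t)   ∎)
    where
    open ≤-Reasoning
    four-squares : ∀ s → 2 * s * (2 * s) ≡ 4 * (s * s)
    four-squares = solve-∀
  4<a : 4 < a
  4<a = ≰⇒> λ a≤4 → <⇒≱ 4b<a² (≤-trans (*-monoˡ-≤ a a≤4) (*-monoʳ-≤ 4 a≤b))

pairCount-value : ∀ u o v → pairCount 0 (u + o) u (u + o + v) ≡ (u + suc o) * (suc o + v) + suc o
pairCount-value u o v = begin
  suc (u + o) * suc (u + o + v ∸ u) + (suc ((u + o) ⊓ (u + o + v)) ∸ u)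
    ≡⟨ cong₂ (λ d c → suc (u + o) * suc d + (suc c ∸ u)) slots-y (m≤n⇒m⊓n≡m (m≤m+n (u + o) v)) ⟩
  suc (u + o) * suc (o + v) + (suc (u + o) ∸ u)
    ≡⟨ cong (suc (u + o) * suc (o + v) +_) common-slots ⟩
  suc (u + o) * suc (o + v) + suc o
    ≡⟨ rearrange u o v ⟩
  (u + suc o) * (suc o + v) + suc o ∎
  where
  open ≡-Reasoning
  slots-y : u + o + v ∸ u ≡ o + v
  slots-y = trans (cong (_∸ u) (+-assoc u o v)) (m+n∸m≡n u (o + v))
  common-slots : suc (u + o) ∸ u ≡ suc o
  common-slots = trans (cong (_∸ u) (sym (+-suc u o))) (m+n∸m≡n u (suc o))
  rearrange : ∀ u o v → suc (u + o) * suc (o + v) + suc o ≡ (u + suc o) * (suc o + v) + suc o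
  rearrange = solve-∀

-- The poset of the construction: a chain of length m with the points
-- x = (0 , u+o), y = (u , u+o+v) and the isolated z = (0 , m).
module Witness (m u o v : ℕ) (fits : u + o + v ≤ m) where

  Is : List Interval
  Is = (0 , u + o) ∷ (u , u + o + v) ∷ (0 , m) ∷ []

  N : ℕ
  N = suc (suc (suc m))

  lo≤hi : ∀ k → lo Is k ≤ hi Is k
  lo≤hi 0                   = z≤n
  lo≤hi 1                   = ≤-trans (m≤m+n u o) (m≤m+n (u + o) v)
  lo≤hi 2                   = z≤n
  lo≤hi (suc (suc (suc k))) = z≤n

  no-fourth-point : ∀ k → N ≤ m + suc (suc (suc k))
  no-fourth-point k = ≤-trans (≤-reflexive (+-comm 3 m)) (+-monoʳ-≤ m (s≤s (s≤s (s≤s z≤n))))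

  overlapping : ∀ k k′ → m + k < N → m + k′ < N → lo Is k′ ≤ hi Is k
  overlapping k                   0                    _   _   = z≤n
  overlapping k                   2                    _   _   = z≤n
  overlapping 0                   1                    _   _   = m≤m+n u o
  overlapping 1                   1                    _   _   = lo≤hi 1
  overlapping 2                   1                    _   _   = ≤-trans (lo≤hi 1) fits
  overlapping (suc (suc (suc k))) 1                    out _   = ⊥-elim (<⇒≱ out (no-fourth-point k))
  overlapping k                   (suc (suc (suc k′))) _   out = ⊥-elim (<⇒≱ out (no-fourth-point k′))

  poset : FinPoset
  poset = ChainPoset.poset m Is N lo≤hi overlapping

  e-poset : e poset ≡ N * pairCount 0 (u + o) u (u + o + v)
  e-poset = begin
    e poset
      ≡⟨ e≡E poset ⟩
    chainCount N m Is
      ≡⟨ E-isolatedℕ (chainWith m Is) z (m + 2) toℕ-z _ (point-above-nothing {m} {Is} {2} ≤-refl ∘ toℕ)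
                     (point-below-nothing {m} {Is} {2} refl ∘ toℕ) (chainWith-deletePoint m 2 Is) ⟩
    N * chainCount (suc (suc m)) m (removeInterval 2 Is)
      ≡⟨ cong (N *_) (chainCount-resize m (removeInterval 2 Is) (+-comm 2 m)) ⟩
    N * chainCount (m + 2) m (removeInterval 2 Is)
      ≡⟨ cong (N *_) (chainCount-two m 0 (u + o) u (u + o + v) z≤n (≤-trans (m≤m+n (u + o) v) fits) (lo≤hi 1) fits) ⟩
    N * pairCount 0 (u + o) u (u + o + v) ∎
    where
    open ≡-Reasoning
    z : Fin N
    z = fromℕ (suc (suc m))
    toℕ-z : toℕ z ≡ m + 2
    toℕ-z = trans (toℕ-fromℕ (suc (suc m))) (+-comm 2 m)

corollary4p1 : (a b : ℕ) → 1 ≤ a → 1 ≤ b → 4 * b < a * a → a ≤ b →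
               λ≤√ (a * b)
corollary4p1 a b _ _ 4b<a² a≤b = poset , size-bound , extensions
  where
  open Decomposition (decompose a b 4b<a² a≤b)
  open Witness (a ∸ 3) u o v (m+n≤o⇒m≤o∸n (u + o + v) fits)
  N≡a : N ≡ a
  N≡a = m+[n∸m]≡n (m+n≤o⇒n≤o (u + o + v) fits)
  size-bound : N * N ≤ a * b
  size-bound = subst (λ z → z * z ≤ a * b) (sym N≡a) (*-monoʳ-≤ a a≤b)
  extensions : e poset ≡ a * b
  extensions = trans e-poset (cong₂ _*_ N≡a (trans (pairCount-value u o v) (sym value)))
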